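{- Let $G=(V,E)$ be a finite, connected, undirected graph (multiple edges allowed) with at least one edge, let $\mu^*$ be an optimal pmf for the Fairest Edge Usage problem on $G$ with edge usage probabilities $\eta^*$, and let $E^*=\{e\in E:\eta^*(e)=\max_{e'\in E}\eta^*(e')\}$. If $\gamma\in\operatorname{supp}\mu^*$, then $|\gamma\cap E^*|=\mathcal{M}(E^*)$.
   Context: $\Gamma$ denotes the set of spanning trees of $G$, each viewed as a set of edges. For a probability mass function (pmf) $\mu$ on $\Gamma$, its edge usage probabilities are $\eta(e)=\sum_{\gamma\in\Gamma:\,e\in\gamma}\mu(\gamma)$. The Fairest Edge Usage problem is to minimize $\sum_{e\in E}\eta(e)^2$ over all pmfs $\mu$ on $\Gamma$; a minimizer is an optimal pmf. $\operatorname{supp}\mu=\{\gamma:\mu(\gamma)>0\}$. For $J\subseteq E$, $\mathcal{M}(J)=\min_{\gamma\in\Gamma}|\gamma\cap J|$.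
   Formalization: Every pmf on Γ, the optimal pmf $\mu^*$ as well as every pmf it is compared with in the Fairest Edge Usage problem, takes values in ℚ. -}

module Defs where

open import Data.Nat as ℕ using (ℕ; zero; suc)
open import Data.Fin using (Fin)
open import Data.Fin.Subset using (Subset; ⊤; _∈_; _∉_; _-_; inside; outside)
open import Data.Fin.Subset.Properties using (_∈?_)
open import Data.Vec using (_∷_; [])
open import Data.List using (List; []; _∷_; map; _++_; foldr; length; filter)
open import Data.List.Relation.Unary.All using (All; all?)
open import Data.Product using (_×_; Σ; _,_; ∃)
open import Data.Sum using (_⊎_)
open import Data.Bool using (Bool; if_then_else_; _∧_)
import Data.Bool
open import Relation.Nullary using (¬_; does)
open import Relation.Unary using (Decidable)
open import Relation.Binary.PropositionalEquality using (_≡_)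
open import Data.Rational using (ℚ; 0ℚ; 1ℚ; _+_; _*_; _≤_)
open import Data.Rational.Properties using (_≤?_)
open import Data.Fin.Base using () renaming (toℕ to toℕ)
import Data.List as L

-- Finite undirected multigraph: vertices Fin n, edges Fin m,
-- each edge e has two distinct endpoints (no loops; parallel edges allowed).

record MultiGraph : Set where
  field
    n     : ℕ
    m     : ℕ
    src   : Fin m → Fin n
    tgt   : Fin m → Fin n
    noLoop : ∀ e → ¬ (src e ≡ tgt e)

module _ (G : MultiGraph) where
  open MultiGraph G

  data Reach (T : Subset m) : Fin n → Fin n → Set where
    here : ∀ {u} → Reach T u u
    fwd  : ∀ {v} e → e ∈ T → Reach T (tgt e) v → Reach T (src e) v
    bwd  : ∀ {v} e → e ∈ T → Reach T (src e) v → Reach T (tgt e) v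

  ConnectedSub : Subset m → Set
  ConnectedSub T = ∀ u v → Reach T u v

  Connected : Set
  Connected = ConnectedSub ⊤

  Acyclic : Subset m → Set
  Acyclic T = ∀ e → e ∈ T → ¬ Reach (T - e) (src e) (tgt e)

  SpanningTree : Subset m → Set
  SpanningTree T = ConnectedSub T × Acyclic T

allSubsets : (k : ℕ) → List (Subset k)
allSubsets zero    = [] ∷ []
allSubsets (suc k) = map (inside ∷_) (allSubsets k) ++ map (outside ∷_) (allSubsets k)

sumℚ : List ℚ → ℚ
sumℚ = foldr _+_ 0ℚ

module _ (G : MultiGraph) where
  open MultiGraph G

  -- a probability mass function on the set Γ of spanning trees of G
  -- (represented as a function on all edge subsets vanishing off Γ)
  record PMF : Set where
    field
      μ       : Subset m → ℚ
      nonneg  : ∀ S → 0ℚ ≤ μ S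
      support : ∀ S → ¬ (μ S ≡ 0ℚ) → SpanningTree G S
      total   : sumℚ (map μ (allSubsets m)) ≡ 1ℚ

  η : PMF → Fin m → ℚ
  η p e = sumℚ (map (λ S → if does (e ∈? S) then PMF.μ p S else 0ℚ) (allSubsets m))

  cost : PMF → ℚ
  cost p = sumℚ (map (λ e → η p e * η p e) (L.allFin m))

  Optimal : PMF → Set
  Optimal p = ∀ (q : PMF) → cost p ≤ cost q

  inEstar : PMF → Fin m → Bool
  inEstar p e = does (all? (λ e' → η p e' ≤? η p e) (L.allFin m))

  countIn : Subset m → (Fin m → Bool) → ℕ
  countIn γ J = length (L.filter (λ e → e ∈? γ) (L.filter (λ e → J e Data.Bool.≟ Data.Bool.true) (L.allFin m)))

  IsMinCrossing : (Fin m → Bool) → ℕ → Set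
  IsMinCrossing J k = (Σ (Subset m) λ γ → SpanningTree G γ × countIn γ J ≡ k)
                    × (∀ γ → SpanningTree G γ → k ℕ.≤ countIn γ J)

{-# OPTIONS --safe #-}
module Submission where

-- Let J = E* and let γ be a tree in the support of an optimal μ. Every edge f ∉ J is spanned
-- by γ ∖ J: otherwise the cycle that f closes in γ contains an edge e ∈ J, γ - e + f is again
-- a spanning tree, and moving a small mass ε from γ to it changes the objective by
-- 2ε(ε - (η e - η f)) < 0, because η f < η e. Hence for every spanning tree γ′ the forest
-- γ′ ∖ J is spanned by γ ∖ J, so |γ′ ∖ J| ≤ |γ ∖ J| by the rank inequality of the graphic
-- matroid, while |γ| ≤ |γ′| by the same inequality; together |γ ∩ J| ≤ |γ′ ∩ J|.

open import Defs
open import Data.Nat using (ℕ; suc)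
open import Data.Fin using (Fin)
open import Data.Bool using (Bool)
open import Data.Fin.Subset using (Subset)
open import Relation.Nullary using (¬_)
open import Relation.Binary.PropositionalEquality using (_≡_; refl)
open import Data.Rational using (0ℚ)
open import Data.Product using (_,_)

module FilterLength where

  open import Level using (0ℓ)
  open import Data.List using ([]; _∷_; filter; length)
  open import Data.Nat using (_+_)
  open import Data.Nat.Properties using (+-suc)
  open import Function using (_∘_)
  open import Relation.Unary using (Pred; Decidable)
  open import Relation.Nullary using (yes; no; ¬?)
  open import Relation.Binary.PropositionalEquality using (sym; trans; cong)

  length-filter-split : ∀ {A : Set} {P Q : Pred A 0ℓ} (P? : Decidable P) (Q? : Decidable Q) xs →
    length (filter P? xs) ≡ length (filter P? (filter Q? xs)) + length (filter P? (filter (¬? ∘ Q?) xs))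
  length-filter-split P? Q? []       = refl
  length-filter-split P? Q? (x ∷ xs) with Q? x
  ... | yes _ with P? x
  ...   | yes _ = cong suc (length-filter-split P? Q? xs)
  ...   | no  _ = length-filter-split P? Q? xs
  length-filter-split P? Q? (x ∷ xs) | no _ with P? x
  ...   | yes _ = trans (cong suc (length-filter-split P? Q? xs)) (sym (+-suc _ _))
  ...   | no  _ = length-filter-split P? Q? xs

module Subsets where

  open import Data.Nat using (zero)
  open import Data.Bool using (true; false)
  import Data.Bool as Bool
  open import Data.Vec using ([]; _∷_)
  import Data.Vec as Vec
  open import Data.Vec.Properties using (∷-injectiveʳ; ≡-dec)
  open import Data.Fin.Subset using (_∈_; _∉_; _─_; _-_; ⁅_⁆; inside; outside)
  open import Data.Fin.Subset.Properties using (p─q⊆p; x∈⁅x⁆)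
  open import Data.List using ([]; _∷_; map)
  open import Data.List.Membership.Propositional using () renaming (_∈_ to _∈ₗ_)
  open import Data.List.Membership.Propositional.Properties using (∈-map⁺; ∈-map⁻; ∈-++⁺ˡ; ∈-++⁺ʳ)
  open import Data.List.Relation.Unary.Any using (here)
  open import Data.List.Relation.Unary.All using ([])
  open import Data.List.Relation.Unary.AllPairs using ([]; _∷_)
  open import Data.List.Relation.Unary.Unique.Propositional using (Unique)
  import Data.List.Relation.Unary.Unique.Propositional.Properties as Unique
  open import Data.List.Relation.Binary.Disjoint.Propositional using (Disjoint)
  open import Data.Product using (_×_)
  open import Relation.Binary.Definitions using (DecidableEquality)
  open import Relation.Binary.PropositionalEquality using (_≢_)

  infix 4 _≟ˢ_

  _≟ˢ_ : ∀ {k} → DecidableEquality (Subset k)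
  _≟ˢ_ = ≡-dec Bool._≟_

  x∈p─q⇒x∉q : ∀ {k} {x : Fin k} {p q : Subset k} → x ∈ p ─ q → x ∉ q
  x∈p─q⇒x∉q {p = _ ∷ _} {outside ∷ _} Vec.here ()
  x∈p─q⇒x∉q {p = _ ∷ _} {inside ∷ _}  () Vec.here
  x∈p─q⇒x∉q {p = _ ∷ _} {_ ∷ _}       (Vec.there x∈) (Vec.there x∈q) = x∈p─q⇒x∉q x∈ x∈q

  x∈p-y⁻ : ∀ {k} {x y : Fin k} {p : Subset k} → x ∈ p - y → x ∈ p × x ≢ y
  x∈p-y⁻ {x = x} {y} {p} x∈p-y =
    p─q⊆p p ⁅ y ⁆ x∈p-y , λ { refl → x∈p─q⇒x∉q x∈p-y (x∈⁅x⁆ x) }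

  allSubsets-unique : ∀ k → Unique (allSubsets k)
  allSubsets-unique zero    = [] ∷ []
  allSubsets-unique (suc k) =
    Unique.++⁺ (Unique.map⁺ ∷-injectiveʳ rec) (Unique.map⁺ ∷-injectiveʳ rec) disjoint
    where
    rec : Unique (allSubsets k)
    rec = allSubsets-unique k
    disjoint : Disjoint (map (inside ∷_) (allSubsets k)) (map (outside ∷_) (allSubsets k))
    disjoint (S∈ins , S∈outs) with ∈-map⁻ _ S∈ins | ∈-map⁻ _ S∈outs
    ... | _ , _ , refl | _ , _ , ()

  ∈-allSubsets : ∀ {k} (S : Subset k) → S ∈ₗ allSubsets k
  ∈-allSubsets []          = here refl
  ∈-allSubsets (true ∷ S)  = ∈-++⁺ˡ (∈-map⁺ (inside ∷_) (∈-allSubsets S))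
  ∈-allSubsets (false ∷ S) = ∈-++⁺ʳ _ (∈-map⁺ (outside ∷_) (∈-allSubsets S))

module Linkage (G : MultiGraph) where

  open import Level using (0ℓ)
  open import Data.Fin.Properties using (_≟_)
  open import Data.List using (List; []; _∷_; _++_; length)
  open import Data.List.Membership.Propositional using () renaming (_∈_ to _∈ₗ_)
  open import Data.List.Relation.Unary.Any using (here; there)
  open import Data.List.Relation.Binary.Subset.Propositional.Properties
    using (⊆-reflexive-↭; ++⁺ˡ; ∷⁺ʳ; xs⊆ys++xs)
  open import Data.List.Relation.Binary.Permutation.Propositional using (↭-sym)
  open import Data.List.Relation.Binary.Permutation.Propositional.Properties using (shift)
  open import Data.Nat using (_≤_; z≤n; s≤s)
  open import Data.Nat.Properties using (m≤n⇒m≤1+n)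
  open import Data.Product using (_×_; ∃-syntax; map₁)
  open import Data.Sum using (_⊎_; inj₁; inj₂; map₂)
  open import Data.Unit using (⊤; tt)
  open import Data.Empty using (⊥-elim)
  open import Function using (_∘_)
  open import Relation.Unary using (Pred; _⊆_; _∪_; ｛_｝)
  open import Relation.Nullary using (Dec; yes; no)
  open import Relation.Nullary.Decidable using (map′; _⊎-dec_; _×-dec_)
  open import Relation.Binary.PropositionalEquality using (_≢_; sym; trans; cong; subst)
  open MultiGraph G

  infixr 5 _⨾_

  data Linked (P : Pred (Fin m) 0ℓ) : Fin n → Fin n → Set where
    nil  : ∀ {u} → Linked P u u
    rev  : ∀ {u v} → Linked P u v → Linked P v u
    _⨾_  : ∀ {u v w} → Linked P u v → Linked P v w → Linked P u w
    edge : ∀ {e} → P e → Linked P (src e) (tgt e)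

  Spanned : Pred (Fin m) 0ℓ → Fin m → Set
  Spanned P e = Linked P (src e) (tgt e)

  Linked-mono : ∀ {P Q} → P ⊆ Q → ∀ {u v} → Linked P u v → Linked Q u v
  Linked-mono P⊆Q nil      = nil
  Linked-mono P⊆Q (rev r)  = rev (Linked-mono P⊆Q r)
  Linked-mono P⊆Q (r ⨾ s)  = Linked-mono P⊆Q r ⨾ Linked-mono P⊆Q s
  Linked-mono P⊆Q (edge x) = edge (P⊆Q x)

  Linked-absorb : ∀ {P y} → Spanned P y → ∀ {u v} → Linked (｛ y ｝ ∪ P) u v → Linked P u v
  Linked-absorb y-spanned nil                = nil
  Linked-absorb y-spanned (rev r)            = rev (Linked-absorb y-spanned r)
  Linked-absorb y-spanned (r ⨾ s)            = Linked-absorb y-spanned r ⨾ Linked-absorb y-spanned s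
  Linked-absorb y-spanned (edge (inj₁ refl)) = y-spanned
  Linked-absorb y-spanned (edge (inj₂ x))    = edge x

  Through : Pred (Fin m) 0ℓ → Fin m → Fin n → Fin n → Set
  Through P y a b = (Linked P a (src y) × Linked P (tgt y) b) ⊎ (Linked P a (tgt y) × Linked P (src y) b)

  LinkedVia : Pred (Fin m) 0ℓ → Fin m → Fin n → Fin n → Set
  LinkedVia P y a b = Linked P a b ⊎ Through P y a b

  LinkedVia-sym : ∀ {P y a b} → LinkedVia P y a b → LinkedVia P y b a
  LinkedVia-sym (inj₁ r)              = inj₁ (rev r)
  LinkedVia-sym (inj₂ (inj₁ (r , s))) = inj₂ (inj₂ (rev s , rev r))
  LinkedVia-sym (inj₂ (inj₂ (r , s))) = inj₂ (inj₁ (rev s , rev r))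

  LinkedVia-trans : ∀ {P y a b c} → LinkedVia P y a b → LinkedVia P y b c → LinkedVia P y a c
  LinkedVia-trans (inj₁ r)              (inj₁ s)              = inj₁ (r ⨾ s)
  LinkedVia-trans (inj₁ r)              (inj₂ (inj₁ (s , t))) = inj₂ (inj₁ (r ⨾ s , t))
  LinkedVia-trans (inj₁ r)              (inj₂ (inj₂ (s , t))) = inj₂ (inj₂ (r ⨾ s , t))
  LinkedVia-trans (inj₂ (inj₁ (r , s))) (inj₁ t)              = inj₂ (inj₁ (r , s ⨾ t))
  LinkedVia-trans (inj₂ (inj₂ (r , s))) (inj₁ t)              = inj₂ (inj₂ (r , s ⨾ t))
  LinkedVia-trans (inj₂ (inj₁ (r , s))) (inj₂ (inj₁ (_ , t))) = inj₂ (inj₁ (r , t))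
  LinkedVia-trans (inj₂ (inj₂ (r , s))) (inj₂ (inj₂ (_ , t))) = inj₂ (inj₂ (r , t))
  LinkedVia-trans (inj₂ (inj₁ (r , s))) (inj₂ (inj₂ (_ , t))) = inj₁ (r ⨾ t)
  LinkedVia-trans (inj₂ (inj₂ (r , s))) (inj₂ (inj₁ (_ , t))) = inj₁ (r ⨾ t)

  Linked-add⁻ : ∀ {P y a b} → Linked (｛ y ｝ ∪ P) a b → LinkedVia P y a b
  Linked-add⁻ nil                = inj₁ nil
  Linked-add⁻ (rev r)            = LinkedVia-sym (Linked-add⁻ r)
  Linked-add⁻ (r ⨾ s)            = LinkedVia-trans (Linked-add⁻ r) (Linked-add⁻ s)
  Linked-add⁻ (edge (inj₁ refl)) = inj₂ (inj₁ (nil , nil))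
  Linked-add⁻ (edge (inj₂ x))    = inj₁ (edge x)

  Linked-add⁺ : ∀ {P y a b} → LinkedVia P y a b → Linked (｛ y ｝ ∪ P) a b
  Linked-add⁺ (inj₁ r)              = Linked-mono inj₂ r
  Linked-add⁺ (inj₂ (inj₁ (r , s))) = Linked-mono inj₂ r ⨾ edge (inj₁ refl) ⨾ Linked-mono inj₂ s
  Linked-add⁺ (inj₂ (inj₂ (r , s))) = Linked-mono inj₂ r ⨾ rev (edge (inj₁ refl)) ⨾ Linked-mono inj₂ s

  Through-mono : ∀ {P Q} → P ⊆ Q → ∀ {y a b} → Through P y a b → Through Q y a b
  Through-mono P⊆Q (inj₁ (r , s)) = inj₁ (Linked-mono P⊆Q r , Linked-mono P⊆Q s)
  Through-mono P⊆Q (inj₂ (r , s)) = inj₂ (Linked-mono P⊆Q r , Linked-mono P⊆Q s)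

  LinkedVia-through : ∀ {P y a b} → ¬ Linked P a b → LinkedVia P y a b → Through P y a b
  LinkedVia-through ¬r (inj₁ r) = ⊥-elim (¬r r)
  LinkedVia-through ¬r (inj₂ t) = t

  Through-exchange : ∀ {P y g} → Through P y (src g) (tgt g) → Spanned (｛ g ｝ ∪ P) y
  Through-exchange (inj₁ (r , s)) = rev (Linked-mono inj₂ r) ⨾ edge (inj₁ refl) ⨾ rev (Linked-mono inj₂ s)
  Through-exchange (inj₂ (r , s)) = Linked-mono inj₂ s ⨾ rev (edge (inj₁ refl)) ⨾ Linked-mono inj₂ r

  ∈-∷⁻ : ∀ {y} {L : List (Fin m)} → (_∈ₗ y ∷ L) ⊆ ｛ y ｝ ∪ (_∈ₗ L)
  ∈-∷⁻ (here x≡y)  = inj₁ (sym x≡y)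
  ∈-∷⁻ (there x∈L) = inj₂ x∈L

  ∈-∷⁺ : ∀ {y} {L : List (Fin m)} → ｛ y ｝ ∪ (_∈ₗ L) ⊆ (_∈ₗ y ∷ L)
  ∈-∷⁺ (inj₁ y≡x) = here (sym y≡x)
  ∈-∷⁺ (inj₂ x∈L) = there x∈L

  ∈-shift : ∀ {y : Fin m} X Z → (_∈ₗ X ++ y ∷ Z) ⊆ (_∈ₗ y ∷ X ++ Z)
  ∈-shift {y} X Z = ⊆-reflexive-↭ (shift y X Z)

  Linked-[] : ∀ {a b} → Linked (_∈ₗ []) a b → a ≡ b
  Linked-[] nil     = refl
  Linked-[] (rev r) = sym (Linked-[] r)
  Linked-[] (r ⨾ s) = trans (Linked-[] r) (Linked-[] s)
  Linked-[] (edge ())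

  Linked? : ∀ L a b → Dec (Linked (_∈ₗ L) a b)
  Linked? []      a b = map′ (λ { refl → nil }) Linked-[] (a ≟ b)
  Linked? (y ∷ L) a b = map′ (Linked-mono ∈-∷⁺ ∘ Linked-add⁺) (Linked-add⁻ ∘ Linked-mono ∈-∷⁻)
    (Linked? L a b ⊎-dec ((Linked? L a (src y) ×-dec Linked? L (tgt y) b)
                          ⊎-dec (Linked? L a (tgt y) ×-dec Linked? L (src y) b)))

  essential-edge : ∀ L W {a b} → Linked (_∈ₗ L ++ W) a b → ¬ Linked (_∈ₗ W) a b
                 → ∃[ e ] e ∈ₗ L × Through (λ x → x ∈ₗ L ++ W × x ≢ e) e a b
  essential-edge []      W r ¬r = ⊥-elim (¬r r)
  essential-edge (e ∷ L) W {a} {b} r ¬r with Linked? (L ++ W) a b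
  ... | yes r′ = let e′ , e′∈L , through = essential-edge L W r′ ¬r in
                 e′ , there e′∈L , Through-mono (map₁ there) through
  ... | no ¬r′ =
    e , here refl , LinkedVia-through (¬r′ ∘ Linked-mono drop-e) (Linked-add⁻ (Linked-mono split-e r))
    where
    split-e : (_∈ₗ e ∷ L ++ W) ⊆ ｛ e ｝ ∪ (λ x → x ∈ₗ e ∷ L ++ W × x ≢ e)
    split-e {x} x∈ with e ≟ x
    ... | yes e≡x = inj₁ e≡x
    ... | no  e≢x = inj₂ (x∈ , e≢x ∘ sym)
    drop-e : (λ x → x ∈ₗ e ∷ L ++ W × x ≢ e) ⊆ (_∈ₗ L ++ W)
    drop-e (here x≡e , x≢e) = ⊥-elim (x≢e x≡e)
    drop-e (there x∈ , _)   = x∈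

  -- Independent Z X: X is a forest of G with the edges Z contracted, listed so that no edge
  -- is spanned by the edges after it together with Z.
  Independent : List (Fin m) → List (Fin m) → Set
  Independent Z []      = ⊤
  Independent Z (x ∷ X) = ¬ Spanned (_∈ₗ X ++ Z) x × Independent Z X

  data Contracted (y : Fin m) (Z X : List (Fin m)) : Set where
    stays : Independent (y ∷ Z) X → Contracted y Z X
    loses : ∀ X′ → Independent (y ∷ Z) X′ → (_∈ₗ X′) ⊆ (_∈ₗ X) →
            length X ≡ suc (length X′) → Spanned (_∈ₗ X ++ Z) y → Contracted y Z X

  contract : ∀ y Z X → Independent Z X → Contracted y Z X
  contract y Z []      _                  = stays tt
  contract y Z (x ∷ X) (x∉⟨X+Z⟩ , X-indep) with contract y Z X X-indep
  ... | loses X′ X′-indep X′⊆X len y∈⟨X+Z⟩ =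
    loses (x ∷ X′) (x∉⟨X′+y+Z⟩ , X′-indep) (∷⁺ʳ x X′⊆X) (cong suc len)
          (Linked-mono there y∈⟨X+Z⟩)
    where
    x∉⟨X′+y+Z⟩ : ¬ Spanned (_∈ₗ X′ ++ y ∷ Z) x
    x∉⟨X′+y+Z⟩ =
      x∉⟨X+Z⟩ ∘ Linked-absorb y∈⟨X+Z⟩ ∘ Linked-mono (map₂ (++⁺ˡ Z X′⊆X) ∘ ∈-∷⁻ ∘ ∈-shift X′ Z)
  ... | stays X-indep′ with Linked? (X ++ y ∷ Z) (src x) (tgt x)
  ...   | no  x∉⟨X+y+Z⟩ = stays (x∉⟨X+y+Z⟩ , X-indep′)
  ...   | yes x∈⟨X+y+Z⟩ = loses X X-indep′ there refl (Linked-mono ∈-∷⁺ (Through-exchange through))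
    where
    through : Through (_∈ₗ X ++ Z) y (src x) (tgt x)
    through = LinkedVia-through x∉⟨X+Z⟩ (Linked-add⁻ (Linked-mono (∈-∷⁻ ∘ ∈-shift X Z) x∈⟨X+y+Z⟩))

  -- The rank inequality of the graphic matroid: contracting the edges of Y one at a time,
  -- each contraction costs X at most one edge.
  independent-≤-spanning : ∀ Y Z X → Independent Z X → (_∈ₗ X) ⊆ Spanned (_∈ₗ Y ++ Z) →
                           length X ≤ length Y
  independent-≤-spanning []      Z []      _            _   = z≤n
  independent-≤-spanning []      Z (x ∷ X) (x∉⟨X+Z⟩ , _) X⊆⟨Z⟩ =
    ⊥-elim (x∉⟨X+Z⟩ (Linked-mono (xs⊆ys++xs Z X) (X⊆⟨Z⟩ (here refl))))
  independent-≤-spanning (y ∷ Y) Z X X-indep X⊆⟨y+Y+Z⟩ = by-cases (contract y Z X X-indep)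
    where
    reassociate : Spanned (_∈ₗ y ∷ Y ++ Z) ⊆ Spanned (_∈ₗ Y ++ y ∷ Z)
    reassociate = Linked-mono (⊆-reflexive-↭ (↭-sym (shift y Y Z)))
    by-cases : Contracted y Z X → length X ≤ suc (length Y)
    by-cases (stays X-indep′) =
      m≤n⇒m≤1+n (independent-≤-spanning Y (y ∷ Z) X X-indep′ (reassociate ∘ X⊆⟨y+Y+Z⟩))
    by-cases (loses X′ X′-indep X′⊆X |X|≡1+|X′| _) = subst (_≤ suc (length Y)) (sym |X|≡1+|X′|)
      (s≤s (independent-≤-spanning Y (y ∷ Z) X′ X′-indep (reassociate ∘ X⊆⟨y+Y+Z⟩ ∘ X′⊆X)))

module SpanningTrees (G : MultiGraph) where

  open import Data.Fin.Properties using (_≟_)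
  open import Data.Fin.Subset using (_∈_; _∉_; _-_; ⁅_⁆)
  import Data.Fin.Subset as Subset
  open import Data.Fin.Subset.Properties
    using (_∈?_; x∈p∧x≢y⇒x∈p-y; x∈⁅x⁆; x∈⁅y⁆⇒x≡y; x∈p∪q⁻; x∈p∪q⁺)
  open import Data.List using (List; []; _∷_; _++_; filter; length; allFin)
  open import Data.List.Properties using (++-identityʳ)
  open import Data.List.Membership.Propositional using () renaming (_∈_ to _∈ₗ_)
  open import Data.List.Membership.Propositional.Properties using (∈-filter⁺; ∈-filter⁻; ∈-allFin; ∈-++⁺ˡ)
  open import Data.List.Relation.Unary.Any using (here; there)
  open import Data.List.Relation.Unary.All as All using ()
  open import Data.List.Relation.Unary.AllPairs using ([]; _∷_)
  open import Data.List.Relation.Unary.Unique.Propositional using (Unique)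
  import Data.List.Relation.Unary.Unique.Propositional.Properties as Unique
  open import Data.Nat using (_≤_)
  open import Data.Product using (_×_; proj₂; uncurry)
  open import Data.Sum using (_⊎_; inj₁; inj₂)
  open import Data.Unit using (tt)
  open import Function using (id; _∘_)
  open import Data.Empty using (⊥-elim)
  open import Relation.Unary using (_⊆_; _∪_; ｛_｝)
  open import Relation.Nullary using (yes; no)
  open import Relation.Binary.PropositionalEquality using (_≢_; sym; subst)
  open MultiGraph G
  open Linkage G
  open Subsets

  Reach-trans : ∀ {T u v w} → Reach G T u v → Reach G T v w → Reach G T u w
  Reach-trans Reach.here          r′ = r′
  Reach-trans (Reach.fwd e e∈T r) r′ = Reach.fwd e e∈T (Reach-trans r r′)
  Reach-trans (Reach.bwd e e∈T r) r′ = Reach.bwd e e∈T (Reach-trans r r′)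

  Reach-sym : ∀ {T u v} → Reach G T u v → Reach G T v u
  Reach-sym Reach.here          = Reach.here
  Reach-sym (Reach.fwd e e∈T r) = Reach-trans (Reach-sym r) (Reach.bwd e e∈T Reach.here)
  Reach-sym (Reach.bwd e e∈T r) = Reach-trans (Reach-sym r) (Reach.fwd e e∈T Reach.here)

  Reach⇒Linked : ∀ {T u v} → Reach G T u v → Linked (_∈ T) u v
  Reach⇒Linked Reach.here          = nil
  Reach⇒Linked (Reach.fwd e e∈T r) = edge e∈T ⨾ Reach⇒Linked r
  Reach⇒Linked (Reach.bwd e e∈T r) = rev (edge e∈T) ⨾ Reach⇒Linked r

  Linked⇒Reach : ∀ {T u v} → Linked (_∈ T) u v → Reach G T u v
  Linked⇒Reach nil            = Reach.here
  Linked⇒Reach (rev r)        = Reach-sym (Linked⇒Reach r)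
  Linked⇒Reach (r ⨾ s)        = Reach-trans (Linked⇒Reach r) (Linked⇒Reach s)
  Linked⇒Reach (edge {e} e∈T) = Reach.fwd e e∈T Reach.here

  acyclic⇒unspanned : ∀ {γ e P} → Acyclic G γ → e ∈ γ → P ⊆ (λ x → x ∈ γ × x ≢ e) → ¬ Spanned P e
  acyclic⇒unspanned {γ} {e} γ-acyclic e∈γ P⊆γ-e e-spanned =
    γ-acyclic e e∈γ
      (Linked⇒Reach (Linked-mono (λ x∈P → uncurry x∈p∧x≢y⇒x∈p-y (P⊆γ-e x∈P)) e-spanned))

  acyclic⇒independent : ∀ {γ X} → Acyclic G γ → Unique X → (_∈ₗ X) ⊆ (_∈ γ) → Independent [] X
  acyclic⇒independent {X = []}    _          _            _    = tt
  acyclic⇒independent {γ} {x ∷ X} γ-acyclic (x∉X ∷ X!) x∷X⊆γ =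
    acyclic⇒unspanned γ-acyclic (x∷X⊆γ (here refl)) X⊆γ-x ,
    acyclic⇒independent γ-acyclic X! (x∷X⊆γ ∘ there)
    where
    X⊆γ-x : (_∈ₗ X ++ []) ⊆ (λ y → y ∈ γ × y ≢ x)
    X⊆γ-x {y} y∈X++[] = x∷X⊆γ (there y∈X) , λ y≡x → All.lookup x∉X y∈X (sym y≡x)
      where
      y∈X : y ∈ₗ X
      y∈X = subst (_ ∈ₗ_) (++-identityʳ X) y∈X++[]

  exchange : Subset m → Fin m → Fin m → Subset m
  exchange γ e f = (γ - e) Subset.∪ ⁅ f ⁆

  module _ {γ : Subset m} {e f : Fin m} where

    ∈-exchange⁻ : ∀ {x} → x ∈ exchange γ e f → (x ∈ γ × x ≢ e) ⊎ x ≡ f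
    ∈-exchange⁻ x∈T with x∈p∪q⁻ (γ - e) ⁅ f ⁆ x∈T
    ... | inj₁ x∈γ-e = inj₁ (x∈p-y⁻ x∈γ-e)
    ... | inj₂ x∈⁅f⁆ = inj₂ (x∈⁅y⁆⇒x≡y f x∈⁅f⁆)

    ∈-exchange⁺ : ∀ {x} → x ∈ γ → x ≢ e → x ∈ exchange γ e f
    ∈-exchange⁺ x∈γ x≢e = x∈p∪q⁺ (inj₁ (x∈p∧x≢y⇒x∈p-y x∈γ x≢e))

    f∈exchange : f ∈ exchange γ e f
    f∈exchange = x∈p∪q⁺ (inj₂ (x∈⁅x⁆ f))

    ∉-exchange : e ∈ γ → f ∉ γ → e ∉ exchange γ e f
    ∉-exchange e∈γ f∉γ e∈T with ∈-exchange⁻ e∈T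
    ... | inj₁ (_ , e≢e) = e≢e refl
    ... | inj₂ refl      = f∉γ e∈γ

    exchange-agrees : ∀ x → x ≢ e → x ≢ f →
                      (x ∈ γ → x ∈ exchange γ e f) × (x ∈ exchange γ e f → x ∈ γ)
    exchange-agrees x x≢e x≢f =
      (λ x∈γ → ∈-exchange⁺ x∈γ x≢e) , λ x∈T → from-exchange (∈-exchange⁻ x∈T)
      where
      from-exchange : (x ∈ γ × x ≢ e) ⊎ x ≡ f → x ∈ γ
      from-exchange (inj₁ (x∈γ , _)) = x∈γ
      from-exchange (inj₂ x≡f)       = ⊥-elim (x≢f x≡f)

    exchange-connected : ConnectedSub G γ → Spanned (_∈ exchange γ e f) e →
                         ConnectedSub G (exchange γ e f)
    exchange-connected γ-connected e-spanned u v =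
      Linked⇒Reach (Linked-absorb e-spanned (Linked-mono γ⊆e+T (Reach⇒Linked (γ-connected u v))))
      where
      γ⊆e+T : (_∈ γ) ⊆ ｛ e ｝ ∪ (_∈ exchange γ e f)
      γ⊆e+T {x} x∈γ with e ≟ x
      ... | yes e≡x = inj₁ e≡x
      ... | no  e≢x = inj₂ (∈-exchange⁺ x∈γ (e≢x ∘ sym))

    exchange-unspanned : Acyclic G γ → e ∈ γ → Spanned (_∈ exchange γ e f) e →
                         ¬ Spanned (λ x → x ∈ γ × x ≢ e) f
    exchange-unspanned γ-acyclic e∈γ e-spanned f-spanned =
      acyclic⇒unspanned γ-acyclic e∈γ id (Linked-absorb f-spanned (Linked-mono T⊆f+γ-e e-spanned))
      where
      T⊆f+γ-e : (_∈ exchange γ e f) ⊆ ｛ f ｝ ∪ (λ x → x ∈ γ × x ≢ e)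
      T⊆f+γ-e x∈T with ∈-exchange⁻ x∈T
      ... | inj₁ x∈γ-e = inj₂ x∈γ-e
      ... | inj₂ x≡f   = inj₁ (sym x≡f)

    -- A cycle of γ - e + f through g ≠ f either avoids f, and so lies in γ, or passes
    -- through f, and then trading f for g shows that f is spanned by γ - e.
    exchange-acyclic : Acyclic G γ → e ∈ γ → Spanned (_∈ exchange γ e f) e →
                       Acyclic G (exchange γ e f)
    exchange-acyclic γ-acyclic e∈γ e-spanned g g∈T g-reach with ∈-exchange⁻ g∈T
    ... | inj₂ refl =
      exchange-unspanned γ-acyclic e∈γ e-spanned (Linked-mono T-f⊆γ-e (Reach⇒Linked g-reach))
      where
      T-f⊆γ-e : (_∈ exchange γ e f - f) ⊆ (λ x → x ∈ γ × x ≢ e)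
      T-f⊆γ-e x∈T-f with x∈p-y⁻ x∈T-f
      ... | x∈T , x≢f with ∈-exchange⁻ x∈T
      ...   | inj₁ x∈γ-e = x∈γ-e
      ...   | inj₂ x≡f   = ⊥-elim (x≢f x≡f)
    ... | inj₁ (g∈γ , g≢e) with Linked-add⁻ (Linked-mono T-g⊆f+γ-e-g (Reach⇒Linked g-reach))
      where
      T-g⊆f+γ-e-g : (_∈ exchange γ e f - g) ⊆ ｛ f ｝ ∪ (λ x → x ∈ γ × x ≢ e × x ≢ g)
      T-g⊆f+γ-e-g x∈T-g with x∈p-y⁻ x∈T-g
      ... | x∈T , x≢g with ∈-exchange⁻ x∈T
      ...   | inj₁ (x∈γ , x≢e) = inj₂ (x∈γ , x≢e , x≢g)
      ...   | inj₂ x≡f         = inj₁ (sym x≡f)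
    ...   | inj₁ g-spanned =
      acyclic⇒unspanned γ-acyclic g∈γ (λ (x∈γ , _ , x≢g) → x∈γ , x≢g) g-spanned
    ...   | inj₂ through   =
      exchange-unspanned γ-acyclic e∈γ e-spanned (Linked-mono g+γ-e-g⊆γ-e (Through-exchange through))
      where
      g+γ-e-g⊆γ-e : ｛ g ｝ ∪ (λ x → x ∈ γ × x ≢ e × x ≢ g) ⊆ (λ x → x ∈ γ × x ≢ e)
      g+γ-e-g⊆γ-e (inj₁ refl)                = g∈γ , g≢e
      g+γ-e-g⊆γ-e (inj₂ (x∈γ , x≢e , _)) = x∈γ , x≢e

    exchange-spanningTree : SpanningTree G γ → e ∈ γ → Spanned (_∈ exchange γ e f) e →
                            SpanningTree G (exchange γ e f)
    exchange-spanningTree (γ-connected , γ-acyclic) e∈γ e-spanned =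
      exchange-connected γ-connected e-spanned , exchange-acyclic γ-acyclic e∈γ e-spanned

  elements : Subset m → List (Fin m)
  elements S = filter (_∈? S) (allFin m)

  ∈-elements⁺ : ∀ {S x} → x ∈ S → x ∈ₗ elements S
  ∈-elements⁺ {S} {x} = ∈-filter⁺ (_∈? S) (∈-allFin x)

  ∈-elements⁻ : ∀ {S x} → x ∈ₗ elements S → x ∈ S
  ∈-elements⁻ {S} = proj₂ ∘ ∈-filter⁻ (_∈? S) {xs = allFin m}

  elements-unique : ∀ S → Unique (elements S)
  elements-unique S = Unique.filter⁺ (_∈? S) (Unique.allFin⁺ m)

  acyclic-≤-connected : ∀ {γ γ′} → Acyclic G γ → ConnectedSub G γ′ →
                        length (elements γ) ≤ length (elements γ′)
  acyclic-≤-connected {γ} {γ′} γ-acyclic γ′-connected =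
    independent-≤-spanning (elements γ′) [] (elements γ)
      (acyclic⇒independent γ-acyclic (elements-unique γ) ∈-elements⁻)
      (λ _ → Linked-mono (∈-++⁺ˡ ∘ ∈-elements⁺) (Reach⇒Linked (γ′-connected _ _)))

module Crossing (G : MultiGraph) (J : Fin (MultiGraph.m G) → Bool) where

  open import Data.Bool using (true)
  import Data.Bool as Bool
  open import Data.Fin.Subset using (_∈_; _∉_)
  open import Data.Fin.Subset.Properties using (_∈?_)
  open import Data.List using (List; []; _++_; filter; length; allFin)
  open import Data.List.Membership.Propositional using () renaming (_∈_ to _∈ₗ_)
  open import Data.List.Membership.Propositional.Properties
    using (∈-filter⁺; ∈-filter⁻; ∈-allFin; ∈-++⁺ˡ; ∈-++⁺ʳ; ∈-++⁻)
  open import Data.List.Relation.Unary.Unique.Propositional using (Unique)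
  import Data.List.Relation.Unary.Unique.Propositional.Properties as Unique
  open import Data.Nat using (_≤_; _+_)
  open import Data.Nat.Properties using (+-cancelʳ-≤; +-monoʳ-≤; module ≤-Reasoning)
  open import Data.Product using (_×_; proj₁; proj₂; ∃-syntax)
  open import Data.Sum using (inj₁; inj₂)
  open import Function using (_∘_)
  open import Relation.Unary using (Decidable; _⊆_; _∪_; ｛_｝)
  open import Relation.Nullary using (yes; no; ¬?)
  open import Relation.Binary.PropositionalEquality using (_≢_; sym)
  open MultiGraph G
  open Linkage G
  open SpanningTrees G
  open FilterLength

  isJ : Decidable (λ e → J e ≡ true)
  isJ e = J e Bool.≟ true

  J-edges non-J-edges : Subset m → List (Fin m)
  J-edges γ     = filter (_∈? γ) (filter isJ (allFin m))
  non-J-edges γ = filter (_∈? γ) (filter (¬? ∘ isJ) (allFin m))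

  module _ {γ : Subset m} {x : Fin m} where

    ∈-J-edges⁺ : x ∈ γ → J x ≡ true → x ∈ₗ J-edges γ
    ∈-J-edges⁺ x∈γ Jx = ∈-filter⁺ (_∈? γ) (∈-filter⁺ isJ (∈-allFin x) Jx) x∈γ

    ∈-J-edges⁻ : x ∈ₗ J-edges γ → x ∈ γ × J x ≡ true
    ∈-J-edges⁻ x∈ =
      let x∈J , x∈γ = ∈-filter⁻ (_∈? γ) {xs = filter isJ (allFin m)} x∈ in
      x∈γ , proj₂ (∈-filter⁻ isJ {xs = allFin m} x∈J)

    ∈-non-J-edges⁺ : x ∈ γ → J x ≢ true → x ∈ₗ non-J-edges γ
    ∈-non-J-edges⁺ x∈γ ¬Jx = ∈-filter⁺ (_∈? γ) (∈-filter⁺ (¬? ∘ isJ) (∈-allFin x) ¬Jx) x∈γ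

    ∈-non-J-edges⁻ : x ∈ₗ non-J-edges γ → x ∈ γ × J x ≢ true
    ∈-non-J-edges⁻ x∈ =
      let x∈¬J , x∈γ = ∈-filter⁻ (_∈? γ) {xs = filter (¬? ∘ isJ) (allFin m)} x∈ in
      x∈γ , proj₂ (∈-filter⁻ (¬? ∘ isJ) {xs = allFin m} x∈¬J)

    ∈-J-split : x ∈ γ → x ∈ₗ J-edges γ ++ non-J-edges γ
    ∈-J-split x∈γ with isJ x
    ... | yes Jx  = ∈-++⁺ˡ (∈-J-edges⁺ x∈γ Jx)
    ... | no  ¬Jx = ∈-++⁺ʳ (J-edges γ) (∈-non-J-edges⁺ x∈γ ¬Jx)

    ∈-J-split⁻ : x ∈ₗ J-edges γ ++ non-J-edges γ → x ∈ γ
    ∈-J-split⁻ x∈ with ∈-++⁻ (J-edges γ) x∈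
    ... | inj₁ x∈J-edges     = proj₁ (∈-J-edges⁻ x∈J-edges)
    ... | inj₂ x∈non-J-edges = proj₁ (∈-non-J-edges⁻ x∈non-J-edges)

  non-J-edges-unique : ∀ γ → Unique (non-J-edges γ)
  non-J-edges-unique γ = Unique.filter⁺ (_∈? γ) (Unique.filter⁺ (¬? ∘ isJ) (Unique.allFin⁺ m))

  elements-length-split : ∀ γ → length (elements γ) ≡ countIn G γ J + length (non-J-edges γ)
  elements-length-split γ = length-filter-split (_∈? γ) isJ (allFin m)

  crossing-minimal : ∀ {γ γ′} → SpanningTree G γ → SpanningTree G γ′ →
                     (∀ f → J f ≢ true → Spanned (_∈ₗ non-J-edges γ) f) →
                     countIn G γ J ≤ countIn G γ′ J
  crossing-minimal {γ} {γ′} (γ-connected , γ-acyclic) (γ′-connected , γ′-acyclic) non-J-spanned =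
    +-cancelʳ-≤ (length (non-J-edges γ)) _ _ (begin
      countIn G γ J + length (non-J-edges γ)   ≡⟨ sym (elements-length-split γ) ⟩
      length (elements γ)                      ≤⟨ acyclic-≤-connected γ-acyclic γ′-connected ⟩
      length (elements γ′)                     ≡⟨ elements-length-split γ′ ⟩
      countIn G γ′ J + length (non-J-edges γ′) ≤⟨ +-monoʳ-≤ (countIn G γ′ J) non-J-≤ ⟩
      countIn G γ′ J + length (non-J-edges γ)  ∎)
    where
    open ≤-Reasoning
    non-J-≤ : length (non-J-edges γ′) ≤ length (non-J-edges γ)
    non-J-≤ = independent-≤-spanning (non-J-edges γ) [] (non-J-edges γ′)
                (acyclic⇒independent γ′-acyclic (non-J-edges-unique γ′) (proj₁ ∘ ∈-non-J-edges⁻))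
                (λ x∈ → Linked-mono ∈-++⁺ˡ (non-J-spanned _ (proj₂ (∈-non-J-edges⁻ x∈))))

  exchange-partner : ∀ {γ f} → SpanningTree G γ → J f ≢ true → ¬ Spanned (_∈ₗ non-J-edges γ) f →
                     ∃[ e ] e ∈ γ × J e ≡ true × f ∉ γ × Spanned (_∈ exchange γ e f) e
  exchange-partner {γ} {f} (γ-connected , _) ¬Jf f-unspanned
    with essential-edge (J-edges γ) (non-J-edges γ)
           (Linked-mono ∈-J-split (Reach⇒Linked (γ-connected _ _))) f-unspanned
  ... | e , e∈J-edges , through =
    let e∈γ , Je = ∈-J-edges⁻ e∈J-edges in
    e , e∈γ , Je , f∉γ , Linked-mono into-exchange (Through-exchange through)
    where
    f∉γ : f ∉ γ
    f∉γ f∈γ = f-unspanned (edge (∈-non-J-edges⁺ f∈γ ¬Jf))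
    into-exchange : ｛ f ｝ ∪ (λ x → x ∈ₗ J-edges γ ++ non-J-edges γ × x ≢ e) ⊆ (_∈ exchange γ e f)
    into-exchange (inj₁ refl)       = f∈exchange
    into-exchange (inj₂ (x∈ , x≢e)) = ∈-exchange⁺ (∈-J-split⁻ x∈) x≢e

module RationalOrder where

  open import Data.Rational using (_+_; _-_; -_; _*_; _≤_; _<_; ½; positive; negative)
  open import Data.Rational.Properties
  open import Data.Product using (_×_; ∃-syntax)
  open import Relation.Nullary using (yes; no)
  open import Relation.Binary.PropositionalEquality using (subst)
  open import Data.Rational.Solver using (module +-*-Solver)
  open +-*-Solver

  p≤q⇒0≤q-p : ∀ {p q} → p ≤ q → 0ℚ ≤ q - p
  p≤q⇒0≤q-p {p} {q} p≤q = subst (_≤ q - p) (+-inverseʳ p) (+-monoˡ-≤ (- p) p≤q)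

  p<q⇒0<q-p : ∀ {p q} → p < q → 0ℚ < q - p
  p<q⇒0<q-p {p} {q} p<q = subst (_< q - p) (+-inverseʳ p) (+-monoˡ-< (- p) p<q)

  p<q⇒p-q<0 : ∀ {p q} → p < q → p - q < 0ℚ
  p<q⇒p-q<0 {p} {q} p<q = subst (p - q <_) (+-inverseʳ q) (+-monoˡ-< (- q) p<q)

  p+neg<p : ∀ p {q} → q < 0ℚ → p + q < p
  p+neg<p p {q} q<0 = subst (p + q <_) (+-identityʳ p) (+-monoʳ-< p q<0)

  neg+neg<0 : ∀ {p q} → p < 0ℚ → q < 0ℚ → p + q < 0ℚ
  neg+neg<0 {p} {q} p<0 q<0 = subst (p + q <_) (+-identityʳ 0ℚ) (+-mono-< p<0 q<0)

  p*[p-q]<0 : ∀ {p q} → 0ℚ < p → p < q → p * (p - q) < 0ℚ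
  p*[p-q]<0 {p} {q} 0<p p<q =
    negative⁻¹ _ {{pos*neg⇒neg p {{positive 0<p}} (p - q) {{negative (p<q⇒p-q<0 p<q)}}}}

  0<p*½<p : ∀ {p} → 0ℚ < p → 0ℚ < p * ½ × p * ½ < p
  0<p*½<p {p} 0<p = 0<p/2 , subst (p * ½ <_) (solve 1 (λ x → x :* con ½ :+ x :* con ½ := x) refl p)
                                    (subst (_< p * ½ + p * ½) (+-identityʳ (p * ½)) (+-monoʳ-< (p * ½) 0<p/2))
    where
    0<p/2 : 0ℚ < p * ½
    0<p/2 = positive⁻¹ _ {{pos*pos⇒pos p {{positive 0<p}} ½}}

  positive-below : ∀ {a b} → 0ℚ < a → 0ℚ < b → ∃[ ε ] 0ℚ < ε × ε ≤ a × ε < b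
  positive-below {a} {b} 0<a 0<b with a <? b
  ... | yes a<b = a , 0<a , ≤-refl , a<b
  ... | no  a≮b = let 0<b/2 , b/2<b = 0<p*½<p 0<b in
                  b * ½ , 0<b/2 , ≤-trans (<⇒≤ b/2<b) (≮⇒≥ a≮b) , b/2<b

module Sums where

  open import Data.Bool using (true; false; if_then_else_)
  open import Data.List using ([]; _∷_; map)
  open import Data.List.Properties using (map-cong)
  open import Data.List.Membership.Propositional using (_∈_)
  open import Data.List.Relation.Unary.Any using (here; there)
  open import Data.List.Relation.Unary.All as All using (All; []; _∷_)
  open import Data.List.Relation.Unary.AllPairs using (_∷_)
  open import Data.List.Relation.Unary.Unique.Propositional using (Unique)
  open import Function using (_∘_)
  open import Data.Empty using (⊥-elim)
  open import Relation.Nullary using (does; yes; no)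
  open import Relation.Nullary.Decidable using (dec-true; dec-false)
  open import Relation.Binary.Definitions using (DecidableEquality)
  open import Relation.Binary.PropositionalEquality using (sym; trans; cong; cong₂; _≢_; module ≡-Reasoning)
  open import Data.Rational using (ℚ; _+_; _-_)
  import Data.Rational.Properties as ℚ
  open import Data.Rational.Solver using (module +-*-Solver)
  open +-*-Solver

  infix 7 _when_

  _when_ : ℚ → Bool → ℚ
  c when b = if b then c else 0ℚ

  when-+ : ∀ b u v → (u + v) when b ≡ u when b + v when b
  when-+ true  u v = refl
  when-+ false u v = sym (ℚ.+-identityʳ 0ℚ)

  0-when : ∀ b → 0ℚ when b ≡ 0ℚ
  0-when true  = refl
  0-when false = refl

  sumℚ-cong : ∀ {A : Set} {F H : A → ℚ} → (∀ x → F x ≡ H x) → ∀ xs →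
              sumℚ (map F xs) ≡ sumℚ (map H xs)
  sumℚ-cong F≗H xs = cong sumℚ (map-cong F≗H xs)

  module _ {A : Set} (_≟_ : DecidableEquality A) where

    sumℚ-off : ∀ (F : A → ℚ) c {a xs} → All (_≢ a) xs →
               sumℚ (map (λ x → F x + c when does (x ≟ a)) xs) ≡ sumℚ (map F xs)
    sumℚ-off F c []           = refl
    sumℚ-off F c {a} {x ∷ xs} (x≢a ∷ xs≢a) rewrite dec-false (x ≟ a) x≢a =
      cong₂ _+_ (ℚ.+-identityʳ (F x)) (sumℚ-off F c xs≢a)

    sumℚ-bump : ∀ (F : A → ℚ) c {a xs} → Unique xs → a ∈ xs →
                sumℚ (map (λ x → F x + c when does (x ≟ a)) xs) ≡ sumℚ (map F xs) + c
    sumℚ-bump F c {a} {x ∷ xs} (x∉xs ∷ _) (here refl)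
      rewrite dec-true (a ≟ a) refl | sumℚ-off F c (All.map (λ a≢x → a≢x ∘ sym) x∉xs) =
      solve 3 (λ u v w → (u :+ w) :+ v := (u :+ v) :+ w) refl (F a) (sumℚ (map F xs)) c
    sumℚ-bump F c {a} {x ∷ xs} (x∉xs ∷ xs!) (there a∈xs)
      rewrite dec-false (x ≟ a) (All.lookup x∉xs a∈xs) | sumℚ-bump F c xs! a∈xs =
      solve 3 (λ u v w → (u :+ con 0ℚ) :+ (v :+ w) := (u :+ v) :+ w) refl (F x) (sumℚ (map F xs)) c

    sumℚ-two-point : ∀ {F H : A → ℚ} {e f xs} → e ≢ f → Unique xs → e ∈ xs → f ∈ xs →
                     (∀ x → x ≢ e → x ≢ f → F x ≡ H x) →
                     sumℚ (map F xs) ≡ (sumℚ (map H xs) + (F e - H e)) + (F f - H f)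
    sumℚ-two-point {F} {H} {e} {f} {xs} e≢f xs! e∈xs f∈xs F≡H = begin
      sumℚ (map F xs)
        ≡⟨ sumℚ-cong pointwise xs ⟩
      sumℚ (map (λ x → H+δe x + (F f - H f) when does (x ≟ f)) xs)
        ≡⟨ sumℚ-bump H+δe (F f - H f) xs! f∈xs ⟩
      sumℚ (map H+δe xs) + (F f - H f)
        ≡⟨ cong (_+ (F f - H f)) (sumℚ-bump H (F e - H e) xs! e∈xs) ⟩
      (sumℚ (map H xs) + (F e - H e)) + (F f - H f) ∎
      where
      open ≡-Reasoning
      H+δe : A → ℚ
      H+δe x = H x + (F e - H e) when does (x ≟ e)
      pointwise : ∀ x → F x ≡ H+δe x + (F f - H f) when does (x ≟ f)
      pointwise x with x ≟ e | x ≟ f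
      ... | yes refl | yes refl = ⊥-elim (e≢f refl)
      ... | yes refl | no _     = solve 2 (λ a b → a := (b :+ (a :- b)) :+ con 0ℚ) refl (F e) (H e)
      ... | no _     | yes refl = solve 2 (λ a b → a := (b :+ con 0ℚ) :+ (a :- b)) refl (F f) (H f)
      ... | no x≢e   | no x≢f   =
        trans (F≡H x x≢e x≢f) (sym (trans (ℚ.+-identityʳ _) (ℚ.+-identityʳ (H x))))

module MassTransfer (G : MultiGraph) (p : PMF G) where

  open import Data.Fin.Subset using (_∈_; _∉_)
  open import Data.Fin.Subset.Properties using (_∈?_)
  open import Data.List using (map)
  open import Data.List.Membership.Propositional.Properties using (∈-allFin)
  import Data.List.Relation.Unary.Unique.Propositional.Properties as Unique
  open import Data.Product using (_×_)
  open import Data.Empty using (⊥-elim)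
  open import Data.Fin.Properties using (_≟_)
  open import Function using (_∘_)
  open import Relation.Nullary using (does; yes; no)
  open import Relation.Nullary.Decidable using (dec-true; dec-false)
  open import Relation.Binary.PropositionalEquality
    using (_≢_; sym; trans; cong; cong₂; subst; module ≡-Reasoning)
  open import Data.Rational using (ℚ; 1ℚ; _+_; _-_; -_; _*_; _≤_)
  import Data.Rational.Properties as ℚ
  open import Data.Rational.Solver using (module +-*-Solver)
  open +-*-Solver
  open Sums
  open Subsets
  open RationalOrder
  open MultiGraph G
  open PMF p

  when-≟ˢ : ∀ (x : Fin m) (S U : Subset m) c →
            (c when does (S ≟ˢ U)) when does (x ∈? S) ≡ (c when does (x ∈? U)) when does (S ≟ˢ U)
  when-≟ˢ x S U c with S ≟ˢ U
  ... | yes refl = refl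
  ... | no _     = 0-when _

  module _ {γ T : Subset m} (γ-tree : SpanningTree G γ) (T-tree : SpanningTree G T) (γ≢T : γ ≢ T)
           {ε : ℚ} (0≤ε : 0ℚ ≤ ε) (ε≤μγ : ε ≤ μ γ) where

    μ′ : Subset m → ℚ
    μ′ S = (μ S + ε when does (S ≟ˢ T)) + (- ε) when does (S ≟ˢ γ)

    μ′-nonneg : ∀ S → 0ℚ ≤ μ′ S
    μ′-nonneg S with S ≟ˢ T | S ≟ˢ γ
    ... | yes refl | yes refl = ⊥-elim (γ≢T refl)
    ... | yes refl | no _     = subst (0ℚ ≤_) (sym (ℚ.+-identityʳ _)) (ℚ.+-mono-≤ (nonneg S) 0≤ε)
    ... | no _     | yes refl = subst (0ℚ ≤_) (cong (_- ε) (sym (ℚ.+-identityʳ (μ S)))) (p≤q⇒0≤q-p ε≤μγ)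
    ... | no _     | no _     = subst (0ℚ ≤_) (sym (trans (ℚ.+-identityʳ _) (ℚ.+-identityʳ (μ S)))) (nonneg S)

    μ′-support : ∀ S → ¬ μ′ S ≡ 0ℚ → SpanningTree G S
    μ′-support S μ′S≢0 with S ≟ˢ T | S ≟ˢ γ
    ... | yes refl | _        = T-tree
    ... | no _     | yes refl = γ-tree
    ... | no _     | no _     =
      support S (λ μS≡0 → μ′S≢0 (trans (trans (ℚ.+-identityʳ _) (ℚ.+-identityʳ (μ S))) μS≡0))

    μ′-total : sumℚ (map μ′ (allSubsets m)) ≡ 1ℚ
    μ′-total = begin
      sumℚ (map μ′ (allSubsets m))
        ≡⟨ sumℚ-bump _≟ˢ_ (λ S → μ S + ε when does (S ≟ˢ T)) (- ε)
                     (allSubsets-unique m) (∈-allSubsets γ) ⟩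
      sumℚ (map (λ S → μ S + ε when does (S ≟ˢ T)) (allSubsets m)) - ε
        ≡⟨ cong (_- ε) (sumℚ-bump _≟ˢ_ μ ε (allSubsets-unique m) (∈-allSubsets T)) ⟩
      (sumℚ (map μ (allSubsets m)) + ε) - ε
        ≡⟨ cong (λ t → (t + ε) - ε) total ⟩
      (1ℚ + ε) - ε
        ≡⟨ solve 1 (λ t → (con 1ℚ :+ t) :- t := con 1ℚ) refl ε ⟩
      1ℚ ∎
      where open ≡-Reasoning

    transfer : PMF G
    transfer = record { μ = μ′ ; nonneg = μ′-nonneg ; support = μ′-support ; total = μ′-total }

    η-transfer : ∀ x → η G transfer x ≡ (η G p x + ε when does (x ∈? T)) + (- ε) when does (x ∈? γ)
    η-transfer x = begin
      η G transfer x
        ≡⟨ sumℚ-cong restrict (allSubsets m) ⟩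
      sumℚ (map (λ S → raisedAtT S + ((- ε) when does (x ∈? γ)) when does (S ≟ˢ γ)) (allSubsets m))
        ≡⟨ sumℚ-bump _≟ˢ_ raisedAtT _ (allSubsets-unique m) (∈-allSubsets γ) ⟩
      sumℚ (map raisedAtT (allSubsets m)) + (- ε) when does (x ∈? γ)
        ≡⟨ cong (_+ _) (sumℚ-bump _≟ˢ_ (λ S → μ S when does (x ∈? S)) _
                                  (allSubsets-unique m) (∈-allSubsets T)) ⟩
      (η G p x + ε when does (x ∈? T)) + (- ε) when does (x ∈? γ) ∎
      where
      open ≡-Reasoning
      raisedAtT : Subset m → ℚ
      raisedAtT S = μ S when does (x ∈? S) + (ε when does (x ∈? T)) when does (S ≟ˢ T)
      restrict : ∀ S →
                 μ′ S when does (x ∈? S) ≡ raisedAtT S + ((- ε) when does (x ∈? γ)) when does (S ≟ˢ γ)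
      restrict S = trans (when-+ b (μ S + ε when does (S ≟ˢ T)) ((- ε) when does (S ≟ˢ γ)))
                         (cong₂ _+_ (trans (when-+ b (μ S) (ε when does (S ≟ˢ T)))
                                           (cong (μ S when b +_) (when-≟ˢ x S T ε)))
                                    (when-≟ˢ x S γ (- ε)))
        where
        b : Bool
        b = does (x ∈? S)

    module _ {e f : Fin m} (e∈γ : e ∈ γ) (e∉T : e ∉ T) (f∉γ : f ∉ γ) (f∈T : f ∈ T)
             (γ⇔T : ∀ x → x ≢ e → x ≢ f → (x ∈ γ → x ∈ T) × (x ∈ T → x ∈ γ)) where

      η-transfer-off : ∀ x → x ≢ e → x ≢ f → η G transfer x ≡ η G p x
      η-transfer-off x x≢e x≢f with x ∈? γ | γ⇔T x x≢e x≢f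
      ... | yes x∈γ | γ⇒T , _
        rewrite η-transfer x | dec-true (x ∈? γ) x∈γ | dec-true (x ∈? T) (γ⇒T x∈γ) =
        solve 2 (λ a t → (a :+ t) :+ :- t := a) refl (η G p x) ε
      ... | no x∉γ  | _ , T⇒γ
        rewrite η-transfer x | dec-false (x ∈? γ) x∉γ | dec-false (x ∈? T) (x∉γ ∘ T⇒γ) =
        trans (ℚ.+-identityʳ _) (ℚ.+-identityʳ (η G p x))

      η-transfer-out : η G transfer e ≡ η G p e - ε
      η-transfer-out rewrite η-transfer e | dec-false (e ∈? T) e∉T | dec-true (e ∈? γ) e∈γ =
        cong (_- ε) (ℚ.+-identityʳ (η G p e))

      η-transfer-in : η G transfer f ≡ η G p f + ε
      η-transfer-in rewrite η-transfer f | dec-true (f ∈? T) f∈T | dec-false (f ∈? γ) f∉γ =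
        ℚ.+-identityʳ (η G p f + ε)

      cost-transfer : cost G transfer ≡
                      cost G p + (ε * (ε - (η G p e - η G p f)) + ε * (ε - (η G p e - η G p f)))
      cost-transfer = begin
        cost G transfer
          ≡⟨ sumℚ-two-point _≟_ e≢f (Unique.allFin⁺ m) (∈-allFin e) (∈-allFin f)
                            (λ x x≢e x≢f → cong (λ t → t * t) (η-transfer-off x x≢e x≢f)) ⟩
        (cost G p + (square (η G transfer e) - square (η G p e))) + (square (η G transfer f) - square (η G p f))
          ≡⟨ cong₂ (λ s t → (cost G p + (square s - square (η G p e))) + (square t - square (η G p f)))
                   η-transfer-out η-transfer-in ⟩
        (cost G p + (square (η G p e - ε) - square (η G p e))) + (square (η G p f + ε) - square (η G p f))
          ≡⟨ solve 4 (λ c a b t → (c :+ ((a :- t) :* (a :- t) :- a :* a)) :+ ((b :+ t) :* (b :+ t) :- b :* b)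
                                  := c :+ (t :* (t :- (a :- b)) :+ t :* (t :- (a :- b))))
                     refl (cost G p) (η G p e) (η G p f) ε ⟩
        cost G p + (ε * (ε - (η G p e - η G p f)) + ε * (ε - (η G p e - η G p f))) ∎
        where
        open ≡-Reasoning
        square : ℚ → ℚ
        square t = t * t
        e≢f : e ≢ f
        e≢f refl = f∉γ e∈γ

module Optimality (G : MultiGraph) (p : PMF G) where

  open import Data.Bool using (true)
  open import Data.Fin.Subset using (_∈_; _∉_)
  open import Data.List using (allFin)
  open import Data.List.Membership.Propositional using () renaming (_∈_ to _∈ₗ_)
  open import Data.List.Membership.Propositional.Properties using (∈-allFin)
  open import Data.List.Relation.Unary.All as All using (all?)
  open import Data.List.Relation.Unary.All.Properties.Core using (¬All⇒Any¬)
  open import Data.List.Relation.Unary.Any using (satisfied)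
  open import Data.Product using (∃-syntax)
  open import Data.Empty using (⊥-elim)
  open import Relation.Nullary using (yes; no)
  open import Relation.Binary.PropositionalEquality using (_≢_; sym; subst)
  open import Data.Rational using (_≤_; _<_)
  open import Data.Rational.Properties using (_≤?_; ≰⇒>; ≤-antisym; <⇒≤; <-≤-trans; <-irrefl)
  open MultiGraph G
  open PMF p
  open Linkage G
  open SpanningTrees G
  open MassTransfer G p
  open RationalOrder
  open Crossing G (inEstar G p)

  inEstar⇒max : ∀ {e} → inEstar G p e ≡ true → ∀ e′ → η G p e′ ≤ η G p e
  inEstar⇒max {e} e-max e′ with all? (λ e″ → η G p e″ ≤? η G p e) (allFin m) | e-max
  ... | yes all≤ | _  = All.lookup all≤ (∈-allFin e′)
  ... | no  _    | ()

  ¬inEstar⇒exceeded : ∀ {f} → inEstar G p f ≢ true → ∃[ e′ ] η G p f < η G p e′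
  ¬inEstar⇒exceeded {f} f-non-max with all? (λ e″ → η G p e″ ≤? η G p f) (allFin m) | f-non-max
  ... | yes _    | ¬true≡true = ⊥-elim (¬true≡true refl)
  ... | no  ¬all | _          =
    let e′ , ηe′≰ηf = satisfied (¬All⇒Any¬ (λ e″ → η G p e″ ≤? η G p f) (allFin m) ¬all) in
    e′ , ≰⇒> ηe′≰ηf

  inEstar-< : ∀ {e f} → inEstar G p e ≡ true → inEstar G p f ≢ true → η G p f < η G p e
  inEstar-< {e} {f} e-max f-non-max =
    let e′ , ηf<ηe′ = ¬inEstar⇒exceeded {f} f-non-max in <-≤-trans ηf<ηe′ (inEstar⇒max {e} e-max e′)

  μ≢0⇒0<μ : ∀ {γ} → ¬ μ γ ≡ 0ℚ → 0ℚ < μ γ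
  μ≢0⇒0<μ {γ} μγ≢0 = ≰⇒> (λ μγ≤0 → μγ≢0 (≤-antisym μγ≤0 (nonneg γ)))

  exchange-cheaper : ∀ {γ e f} → SpanningTree G γ → ¬ μ γ ≡ 0ℚ → e ∈ γ → f ∉ γ →
                     Spanned (_∈ exchange γ e f) e → η G p f < η G p e → ∃[ q ] cost G q < cost G p
  exchange-cheaper {γ} {e} {f} γ-tree μγ≢0 e∈γ f∉γ e-spanned ηf<ηe
    with positive-below (μ≢0⇒0<μ μγ≢0) (p<q⇒0<q-p ηf<ηe)
  ... | ε , 0<ε , ε≤μγ , ε<ηe-ηf =
    transfer γ-tree T-tree γ≢T (<⇒≤ 0<ε) ε≤μγ ,
    subst (_< cost G p)
          (sym (cost-transfer γ-tree T-tree γ≢T (<⇒≤ 0<ε) ε≤μγ {e} {f}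
                              e∈γ e∉T f∉γ f∈exchange exchange-agrees))
          (p+neg<p (cost G p) (neg+neg<0 (p*[p-q]<0 0<ε ε<ηe-ηf) (p*[p-q]<0 0<ε ε<ηe-ηf)))
    where
    T-tree : SpanningTree G (exchange γ e f)
    T-tree = exchange-spanningTree γ-tree e∈γ e-spanned
    e∉T : e ∉ exchange γ e f
    e∉T = ∉-exchange e∈γ f∉γ
    γ≢T : γ ≢ exchange γ e f
    γ≢T γ≡T = e∉T (subst (e ∈_) γ≡T e∈γ)

  non-max-spanned : Optimal G p → ∀ {γ} → SpanningTree G γ → ¬ μ γ ≡ 0ℚ →
                    ∀ f → inEstar G p f ≢ true → Spanned (_∈ₗ non-J-edges γ) f
  non-max-spanned optimal {γ} γ-tree μγ≢0 f f-non-max with Linked? (non-J-edges γ) (src f) (tgt f)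
  ... | yes f-spanned   = f-spanned
  ... | no  f-unspanned =
    let e , e∈γ , e-max , f∉γ , e-spanned = exchange-partner γ-tree f-non-max f-unspanned
        q , q-cheaper = exchange-cheaper γ-tree μγ≢0 e∈γ f∉γ e-spanned (inEstar-< {e} {f} e-max f-non-max)
    in ⊥-elim (<-irrefl refl (<-≤-trans q-cheaper (optimal q)))

lemma4 : (G : MultiGraph) → Connected G → (m' : ℕ) → MultiGraph.m G ≡ suc m'
       → (p : PMF G) → Optimal G p
       → (γ : Subset (MultiGraph.m G)) → ¬ (PMF.μ p γ ≡ 0ℚ)
       → IsMinCrossing G (inEstar G p) (countIn G γ (inEstar G p))
lemma4 G _ _ _ p optimal γ μγ≢0 =
  (γ , γ-tree , refl) ,
  λ γ′ γ′-tree → crossing-minimal γ-tree γ′-tree (non-max-spanned optimal γ-tree μγ≢0)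
  where
  open Crossing G (inEstar G p)
  open Optimality G p
  γ-tree : SpanningTree G γ
  γ-tree = PMF.support p γ μγ≢0
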